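{- Let $\Sigma$ be a finite alphabet, $k\ge 1$, and let $S_X,S_Y\subseteq\Sigma^k$ be finite sets of $k$-mers. For $0\le j\le k$ let $M_j=|\{(\alpha,\beta)\in S_X\times S_Y: d(\alpha,\beta)=j\}|$. For $0\le i\le k$ let $F_i(X,Y)=\sum_{\theta\in\mathcal{Q}_k(k-i)} f_\theta(X,Y)$. Then for every $0\le i\le k$, $$F_i(X,Y)=\sum_{j=0}^i\binom{k-j}{k-i}M_j.$$
   Context: $d(\cdot,\cdot)$ is Hamming distance on $\Sigma^k$. $\mathcal{Q}_k(j)$ is the set of all $j$-element subsets of $\{1,\ldots,k\}$. For $\theta\in\mathcal{Q}_k(j)$ and a $k$-mer $\alpha$, $\alpha|_\theta$ is the $j$-mer formed by the characters of $\alpha$ at the indices in $\theta$ (in increasing order). $f_\theta(X,Y)=|\{(\alpha,\beta)\in S_X\times S_Y : \alpha|_\theta=\beta|_\theta\}|$. -}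

module Defs where

open import Data.Nat using (ℕ; zero; suc; _+_)
open import Data.Bool using (Bool; true; false)
open import Data.Fin using (Fin)
import Data.Fin as Fin
open import Data.Fin.Subset using (Subset; inside; outside; ∣_∣)
open import Data.Vec using (Vec; []; _∷_)
open import Data.List using (List; []; _∷_; _++_; map; filter; length; cartesianProduct; [_])
open import Data.List.Properties using (≡-dec)
open import Data.Product using (_×_; _,_; proj₁; proj₂)
open import Relation.Nullary using (¬_)
open import Relation.Nullary.Decidable using (¬?)
open import Data.Nat using (_≟_)

KMer : ℕ → ℕ → Set
KMer q k = Vec (Fin q) k

hamming : ∀ {q k} → KMer q k → KMer q k → ℕ
hamming [] [] = 0
hamming (a ∷ as) (b ∷ bs) with a Fin.≟ b
... | Relation.Nullary.yes _ = hamming as bs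
... | Relation.Nullary.no  _ = suc (hamming as bs)

allSubsets : (k : ℕ) → List (Subset k)
allSubsets zero = [ [] ]
allSubsets (suc k) = map (inside ∷_) (allSubsets k) ++ map (outside ∷_) (allSubsets k)

Q : (k j : ℕ) → List (Subset k)
Q k j = filter (λ θ → ∣ θ ∣ ≟ j) (allSubsets k)

restrict : ∀ {A : Set} {k} → Vec A k → Subset k → List A
restrict [] [] = []
restrict (a ∷ as) (true ∷ θ) = a ∷ restrict as θ
restrict (a ∷ as) (false ∷ θ) = restrict as θ

fθ : ∀ {q k} → Subset k → List (KMer q k) → List (KMer q k) → ℕ
fθ θ SX SY = length (filter (λ p → ≡-dec Fin._≟_ (restrict (proj₁ p) θ) (restrict (proj₂ p) θ))
                            (cartesianProduct SX SY))

sumℕ : List ℕ → ℕ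
sumℕ [] = 0
sumℕ (x ∷ xs) = x + sumℕ xs

F : ∀ {q} (k i : ℕ) → List (KMer q k) → List (KMer q k) → ℕ
F k i SX SY = sumℕ (map (λ θ → fθ θ SX SY) (Q k (k Data.Nat.∸ i)))

M : ∀ {q k} (j : ℕ) → List (KMer q k) → List (KMer q k) → ℕ
M j SX SY = length (filter (λ p → hamming (proj₁ p) (proj₂ p) ≟ j) (cartesianProduct SX SY))

-- Double counting.  A pair (α, β) at Hamming distance d agrees exactly on a
-- set of k − d positions, so it is counted by f_θ for precisely the
-- C(k − d, k − i) subsets θ of size k − i inside that agreement set; hence
-- F_i = Σ_{(α,β)} C(k − d(α,β), k − i).  Grouping the pairs by distance gives
-- Σ_j C(k − j, k − i) M_j, and the terms with j > i vanish.
module Submission where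

open import Defs
open import Data.Nat using (ℕ; _≤_; _∸_; suc; _*_)
open import Relation.Binary.PropositionalEquality using (_≡_)
open import Data.Nat.Combinatorics using (_C_)
open import Data.List using (List; map; upTo)
open import Data.List.Relation.Unary.Unique.Propositional using (Unique)

open import Data.Nat using (zero; _+_; z≤n; s≤s; _≟_)
open import Data.Nat.Properties
  using ( +-commutativeSemigroup; +-assoc; +-suc; +-identityʳ; *-zeroʳ; *-identityʳ
        ; *-distribˡ-+; m≤n+m; m+n∸n≡m; ∸-monoʳ-<)
open import Data.Nat.Combinatorics using (nCk+nC[k+1]≡[n+1]C[k+1]; k>n⇒nCk≡0)
open import Data.Bool using (true; false; if_then_else_)
import Data.Fin as Fin
open import Data.Fin.Subset using (Subset; inside; outside; ∣_∣)
open import Data.Fin.Subset.Properties using (_⊆?_)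
open import Data.Vec using ([]; _∷_)
open import Data.List using ([]; _∷_; _++_; filter; length; cartesianProduct; applyUpTo)
open import Data.List.Properties using (≡-dec; map-cong; map-∘; map-++; map-applyUpTo)
open import Data.Product using (_×_; _,_; proj₁; proj₂)
open import Function using (_∘_; id)
open import Relation.Nullary using (Dec; yes; no; does)
open import Relation.Unary using (Pred; Decidable)
open import Level using (0ℓ)
open import Relation.Binary.PropositionalEquality using (refl; sym; trans; cong; cong₂; subst; module ≡-Reasoning)
open import Algebra.Properties.CommutativeSemigroup +-commutativeSemigroup using (interchange)

open ≡-Reasoning

private variable A B : Set

𝟙 : ∀ {P : Set} → Dec P → ℕ
𝟙 P? = if does P? then 1 else 0

sumℕ-++ : ∀ xs ys → sumℕ (xs ++ ys) ≡ sumℕ xs + sumℕ ys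
sumℕ-++ []       ys = refl
sumℕ-++ (x ∷ xs) ys = trans (cong (x +_) (sumℕ-++ xs ys)) (sym (+-assoc x _ _))

sumℕ-map-zero : ∀ {f : A → ℕ} → (∀ x → f x ≡ 0) → ∀ xs → sumℕ (map f xs) ≡ 0
sumℕ-map-zero f≡0 []       = refl
sumℕ-map-zero f≡0 (x ∷ xs) = cong₂ _+_ (f≡0 x) (sumℕ-map-zero f≡0 xs)

sumℕ-map-+ : ∀ (f g : A → ℕ) xs →
  sumℕ (map (λ x → f x + g x) xs) ≡ sumℕ (map f xs) + sumℕ (map g xs)
sumℕ-map-+ f g []       = refl
sumℕ-map-+ f g (x ∷ xs) =
  trans (cong (f x + g x +_) (sumℕ-map-+ f g xs)) (interchange (f x) (g x) _ _)

*-distribˡ-sumℕ : ∀ c (f : A → ℕ) xs → c * sumℕ (map f xs) ≡ sumℕ (map (λ x → c * f x) xs)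
*-distribˡ-sumℕ c f []       = *-zeroʳ c
*-distribˡ-sumℕ c f (x ∷ xs) =
  trans (*-distribˡ-+ c (f x) _) (cong (c * f x +_) (*-distribˡ-sumℕ c f xs))

sumℕ-map-comm : ∀ (g : A → B → ℕ) xs (ys : List B) →
  sumℕ (map (λ x → sumℕ (map (g x) ys)) xs) ≡ sumℕ (map (λ y → sumℕ (map (λ x → g x y) xs)) ys)
sumℕ-map-comm g []       ys = sym (sumℕ-map-zero (λ _ → refl) ys)
sumℕ-map-comm g (x ∷ xs) ys = begin
  sumℕ (map (g x) ys) + sumℕ (map (λ x → sumℕ (map (g x) ys)) xs)
    ≡⟨ cong (sumℕ (map (g x) ys) +_) (sumℕ-map-comm g xs ys) ⟩
  sumℕ (map (g x) ys) + sumℕ (map (λ y → sumℕ (map (λ x → g x y) xs)) ys)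
    ≡⟨ sumℕ-map-+ (g x) _ ys ⟨
  sumℕ (map (λ y → g x y + sumℕ (map (λ x → g x y) xs)) ys) ∎

length-filter≡sumℕ-𝟙 : ∀ {P : Pred A 0ℓ} (P? : Decidable P) xs →
  length (filter P? xs) ≡ sumℕ (map (𝟙 ∘ P?) xs)
length-filter≡sumℕ-𝟙 P? []       = refl
length-filter≡sumℕ-𝟙 P? (x ∷ xs) with does (P? x)
... | true  = cong suc (length-filter≡sumℕ-𝟙 P? xs)
... | false = length-filter≡sumℕ-𝟙 P? xs

sumℕ-map-filter : ∀ {P : Pred A 0ℓ} (P? : Decidable P) (g : A → ℕ) xs →
  sumℕ (map g (filter P? xs)) ≡ sumℕ (map (λ x → 𝟙 (P? x) * g x) xs)
sumℕ-map-filter P? g []       = refl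
sumℕ-map-filter P? g (x ∷ xs) with does (P? x)
... | true  = cong₂ _+_ (sym (+-identityʳ (g x))) (sumℕ-map-filter P? g xs)
... | false = sumℕ-map-filter P? g xs

filter-cong-does : ∀ {P Q : Pred A 0ℓ} (P? : Decidable P) (Q? : Decidable Q) →
  (∀ x → does (P? x) ≡ does (Q? x)) → ∀ xs → filter P? xs ≡ filter Q? xs
filter-cong-does P? Q? eq []       = refl
filter-cong-does P? Q? eq (x ∷ xs) with does (P? x) | does (Q? x) | eq x
... | true  | true  | refl = cong (x ∷_) (filter-cong-does P? Q? eq xs)
... | false | false | refl = filter-cong-does P? Q? eq xs

sumℕ-length-filter-comm : ∀ {R : A → B → Set} (R? : ∀ x y → Dec (R x y)) xs ys →
  sumℕ (map (λ x → length (filter (R? x) ys)) xs) ≡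
  sumℕ (map (λ y → length (filter (λ x → R? x y) xs)) ys)
sumℕ-length-filter-comm R? xs ys = begin
  sumℕ (map (λ x → length (filter (R? x) ys)) xs)
    ≡⟨ cong sumℕ (map-cong (λ x → length-filter≡sumℕ-𝟙 (R? x) ys) xs) ⟩
  sumℕ (map (λ x → sumℕ (map (λ y → 𝟙 (R? x y)) ys)) xs)
    ≡⟨ sumℕ-map-comm (λ x y → 𝟙 (R? x y)) xs ys ⟩
  sumℕ (map (λ y → sumℕ (map (λ x → 𝟙 (R? x y)) xs)) ys)
    ≡⟨ cong sumℕ (map-cong (λ y → length-filter≡sumℕ-𝟙 (λ x → R? x y) xs) ys) ⟨
  sumℕ (map (λ y → length (filter (λ x → R? x y) xs)) ys) ∎

sumℕ-applyUpTo-δ : ∀ (c : ℕ → ℕ) d n → (n ≤ d → c d ≡ 0) →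
  sumℕ (applyUpTo (λ j → c j * 𝟙 (d ≟ j)) n) ≡ c d
sumℕ-applyUpTo-δ c d       zero    c≡0 = sym (c≡0 z≤n)
sumℕ-applyUpTo-δ c zero    (suc n) c≡0 = begin
  c 0 * 1 + sumℕ (applyUpTo (λ j → c (suc j) * 0) n)
    ≡⟨ cong₂ _+_ (*-identityʳ (c 0)) (trans (cong sumℕ (sym (map-applyUpTo id _ n)))
                                           (sumℕ-map-zero (*-zeroʳ ∘ c ∘ suc) (upTo n))) ⟩
  c 0 + 0
    ≡⟨ +-identityʳ (c 0) ⟩
  c 0 ∎
sumℕ-applyUpTo-δ c (suc d) (suc n) c≡0 = begin
  c 0 * 0 + sumℕ (applyUpTo (λ j → c (suc j) * 𝟙 (d ≟ j)) n)
    ≡⟨ cong (_+ sumℕ (applyUpTo (λ j → c (suc j) * 𝟙 (d ≟ j)) n)) (*-zeroʳ (c 0)) ⟩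
  sumℕ (applyUpTo (λ j → c (suc j) * 𝟙 (d ≟ j)) n)
    ≡⟨ sumℕ-applyUpTo-δ (c ∘ suc) d n (c≡0 ∘ s≤s) ⟩
  c (suc d) ∎

sumℕ-upTo-fibres : ∀ (d : A → ℕ) (c : ℕ → ℕ) n xs →
  (∀ x → n ≤ d x → c (d x) ≡ 0) →
  sumℕ (map (λ j → c j * length (filter (λ x → d x ≟ j) xs)) (upTo n)) ≡ sumℕ (map (c ∘ d) xs)
sumℕ-upTo-fibres d c n xs c≡0 = begin
  sumℕ (map (λ j → c j * length (filter (λ x → d x ≟ j) xs)) (upTo n))
    ≡⟨ cong sumℕ (map-cong count-fibre (upTo n)) ⟩
  sumℕ (map (λ j → sumℕ (map (λ x → c j * 𝟙 (d x ≟ j)) xs)) (upTo n))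
    ≡⟨ sumℕ-map-comm (λ j x → c j * 𝟙 (d x ≟ j)) (upTo n) xs ⟩
  sumℕ (map (λ x → sumℕ (map (λ j → c j * 𝟙 (d x ≟ j)) (upTo n))) xs)
    ≡⟨ cong sumℕ (map-cong δ-sum xs) ⟩
  sumℕ (map (c ∘ d) xs) ∎
  where
  count-fibre : ∀ j → c j * length (filter (λ x → d x ≟ j) xs) ≡ sumℕ (map (λ x → c j * 𝟙 (d x ≟ j)) xs)
  count-fibre j = trans (cong (c j *_) (length-filter≡sumℕ-𝟙 (λ x → d x ≟ j) xs))
                        (*-distribˡ-sumℕ (c j) (λ x → 𝟙 (d x ≟ j)) xs)
  δ-sum : ∀ x → sumℕ (map (λ j → c j * 𝟙 (d x ≟ j)) (upTo n)) ≡ c (d x)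
  δ-sum x = trans (cong sumℕ (map-applyUpTo id _ n)) (sumℕ-applyUpTo-δ c (d x) n (c≡0 x))

sumℕ-allSubsets-suc : ∀ k (h : Subset (suc k) → ℕ) →
  sumℕ (map h (allSubsets (suc k))) ≡
  sumℕ (map (h ∘ (inside ∷_)) (allSubsets k)) + sumℕ (map (h ∘ (outside ∷_)) (allSubsets k))
sumℕ-allSubsets-suc k h = begin
  sumℕ (map h (map (inside ∷_) S ++ map (outside ∷_) S))
    ≡⟨ cong sumℕ (map-++ h (map (inside ∷_) S) _) ⟩
  sumℕ (map h (map (inside ∷_) S) ++ map h (map (outside ∷_) S))
    ≡⟨ sumℕ-++ (map h (map (inside ∷_) S)) _ ⟩
  sumℕ (map h (map (inside ∷_) S)) + sumℕ (map h (map (outside ∷_) S))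
    ≡⟨ cong₂ _+_ (cong sumℕ (sym (map-∘ S))) (cong sumℕ (sym (map-∘ S))) ⟩
  sumℕ (map (h ∘ (inside ∷_)) S) + sumℕ (map (h ∘ (outside ∷_)) S) ∎
  where S = allSubsets k

sumℕ-subsets-of-size : ∀ {k} (s : Subset k) m →
  sumℕ (map (λ θ → 𝟙 (∣ θ ∣ ≟ m) * 𝟙 (θ ⊆? s)) (allSubsets k)) ≡ ∣ s ∣ C m
sumℕ-subsets-of-size [] zero    = refl
sumℕ-subsets-of-size [] (suc m) = refl
sumℕ-subsets-of-size {suc k} (inside ∷ s) m
  rewrite sumℕ-allSubsets-suc k (λ θ → 𝟙 (∣ θ ∣ ≟ m) * 𝟙 (θ ⊆? (inside ∷ s)))
        | sumℕ-subsets-of-size s m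
  with m
... | zero  = cong (_+ ∣ s ∣ C 0) (sumℕ-map-zero (λ _ → refl) (allSubsets k))
... | suc m = trans (cong (_+ ∣ s ∣ C suc m) (sumℕ-subsets-of-size s m))
                    (nCk+nC[k+1]≡[n+1]C[k+1] ∣ s ∣ m)
sumℕ-subsets-of-size {suc k} (outside ∷ s) m
  rewrite sumℕ-allSubsets-suc k (λ θ → 𝟙 (∣ θ ∣ ≟ m) * 𝟙 (θ ⊆? (outside ∷ s)))
        | sumℕ-subsets-of-size s m
  = cong (_+ ∣ s ∣ C m) (sumℕ-map-zero (λ θ → *-zeroʳ (𝟙 (suc ∣ θ ∣ ≟ m))) (allSubsets k))

length-Q-⊆ : ∀ {k} (s : Subset k) m → length (filter (_⊆? s) (Q k m)) ≡ ∣ s ∣ C m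
length-Q-⊆ {k} s m = begin
  length (filter (_⊆? s) (Q k m))
    ≡⟨ length-filter≡sumℕ-𝟙 (_⊆? s) (Q k m) ⟩
  sumℕ (map (λ θ → 𝟙 (θ ⊆? s)) (Q k m))
    ≡⟨ sumℕ-map-filter (λ θ → ∣ θ ∣ ≟ m) (λ θ → 𝟙 (θ ⊆? s)) (allSubsets k) ⟩
  sumℕ (map (λ θ → 𝟙 (∣ θ ∣ ≟ m) * 𝟙 (θ ⊆? s)) (allSubsets k))
    ≡⟨ sumℕ-subsets-of-size s m ⟩
  ∣ s ∣ C m ∎

agreement : ∀ {q k} → KMer q k → KMer q k → Subset k
agreement []      []      = []
agreement (a ∷ α) (b ∷ β) = does (a Fin.≟ b) ∷ agreement α β

restrict-≡?-agreement : ∀ {q k} (α β : KMer q k) θ →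
  does (≡-dec Fin._≟_ (restrict α θ) (restrict β θ)) ≡ does (θ ⊆? agreement α β)
restrict-≡?-agreement []      []      []            = refl
restrict-≡?-agreement (a ∷ α) (b ∷ β) (outside ∷ θ) = restrict-≡?-agreement α β θ
restrict-≡?-agreement (a ∷ α) (b ∷ β) (inside ∷ θ) with a Fin.≟ b
... | yes _ = restrict-≡?-agreement α β θ
... | no  _ = refl

∣agreement∣+hamming≡k : ∀ {q k} (α β : KMer q k) → ∣ agreement α β ∣ + hamming α β ≡ k
∣agreement∣+hamming≡k []      []      = refl
∣agreement∣+hamming≡k (a ∷ α) (b ∷ β) with a Fin.≟ b
... | yes _ = cong suc (∣agreement∣+hamming≡k α β)
... | no  _ = trans (+-suc _ _) (cong suc (∣agreement∣+hamming≡k α β))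

∣agreement∣≡k∸hamming : ∀ {q k} (α β : KMer q k) → ∣ agreement α β ∣ ≡ k ∸ hamming α β
∣agreement∣≡k∸hamming α β =
  trans (sym (m+n∸n≡m _ (hamming α β))) (cong (_∸ hamming α β) (∣agreement∣+hamming≡k α β))

hamming≤k : ∀ {q k} (α β : KMer q k) → hamming α β ≤ k
hamming≤k α β = subst (hamming α β ≤_) (∣agreement∣+hamming≡k α β) (m≤n+m _ _)

length-Q-restrict-≡ : ∀ {q k} (α β : KMer q k) m →
  length (filter (λ θ → ≡-dec Fin._≟_ (restrict α θ) (restrict β θ)) (Q k m)) ≡ (k ∸ hamming α β) C m
length-Q-restrict-≡ {k = k} α β m = begin
  length (filter (λ θ → ≡-dec Fin._≟_ (restrict α θ) (restrict β θ)) (Q k m))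
    ≡⟨ cong length (filter-cong-does _ (_⊆? agreement α β) (restrict-≡?-agreement α β) (Q k m)) ⟩
  length (filter (_⊆? agreement α β) (Q k m))
    ≡⟨ length-Q-⊆ (agreement α β) m ⟩
  ∣ agreement α β ∣ C m
    ≡⟨ cong (_C m) (∣agreement∣≡k∸hamming α β) ⟩
  (k ∸ hamming α β) C m ∎

-- The identity holds for arbitrary lists SX, SY (pairs are counted with
-- multiplicity on both sides) and every i, so none of the hypotheses is needed.
lemma7 : (q k : ℕ) → 1 ≤ k → (SX SY : List (KMer q k)) → Unique SX → Unique SY →
    (i : ℕ) → i ≤ k →
    F k i SX SY ≡ sumℕ (map (λ j → ((k ∸ j) C (k ∸ i)) * M j SX SY) (upTo (suc i)))
lemma7 q k _ SX SY _ _ i _ = begin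
  F k i SX SY
    ≡⟨ sumℕ-length-filter-comm (λ θ p → ≡-dec Fin._≟_ (restrict (proj₁ p) θ) (restrict (proj₂ p) θ))
                                (Q k (k ∸ i)) pairs ⟩
  sumℕ (map (λ p → length (filter (λ θ → ≡-dec Fin._≟_ (restrict (proj₁ p) θ) (restrict (proj₂ p) θ))
                                  (Q k (k ∸ i)))) pairs)
    ≡⟨ cong sumℕ (map-cong (λ (α , β) → length-Q-restrict-≡ α β (k ∸ i)) pairs) ⟩
  sumℕ (map (c ∘ d) pairs)
    ≡⟨ sumℕ-upTo-fibres d c (suc i) pairs c-vanishes ⟨
  sumℕ (map (λ j → c j * M j SX SY) (upTo (suc i))) ∎
  where
  pairs : List (KMer q k × KMer q k)
  pairs = cartesianProduct SX SY
  d : KMer q k × KMer q k → ℕ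
  d (α , β) = hamming α β
  c : ℕ → ℕ
  c j = (k ∸ j) C (k ∸ i)
  c-vanishes : ∀ p → suc i ≤ d p → c (d p) ≡ 0
  c-vanishes (α , β) i<d = k>n⇒nCk≡0 (∸-monoʳ-< i<d (hamming≤k α β))
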